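{- Let $k$ be a finite field of odd characteristic, let $A(t)\in k[t]$ be a square-free polynomial of odd degree $d>1$, and let $f(x)\in k[x]$ be a cubic polynomial such that $y^2=f(x)$ defines an elliptic curve over $k$. Let $E_A$ be the elliptic curve over $k(t)$ defined by $A(t)y^2=f(x)$. Suppose $(F,G)$ is a point of $E_A$ with $F,G\in k[t]$ and $F'\neq 0$. Then $G$ divides $F'$ and \[ d/3\leq \deg F < d-1 . \]
   Context: $F'$ denotes the formal derivative of $F$ with respect to $t$. -}

module Defs where

open import Level using (Level; _⊔_) renaming (suc to lsuc)
open import Algebra.Bundles using (CommutativeRing)
open import Data.Nat using (ℕ; zero; suc; _<_)
open import Data.Fin using (Fin)
open import Data.List using (List; []; _∷_; foldr)
open import Data.Product using (Σ; ∃; _×_)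
open import Function.Bundles using (Bijection)
open import Relation.Nullary using (¬_)
import Relation.Binary.PropositionalEquality as ≡

record FiniteField (c ℓ : Level) : Set (lsuc (c ⊔ ℓ)) where
  field
    cring : CommutativeRing c ℓ
  open CommutativeRing cring
  field
    1≉0     : ¬ (1# ≈ 0#)
    inverse : ∀ x → ¬ (x ≈ 0#) → ∃ λ y → x * y ≈ 1#
    size    : ℕ
    enum    : Bijection setoid (≡.setoid (Fin size))

-- Univariate polynomials over a commutative ring, as coefficient lists
-- (constant coefficient first); equality is coefficientwise, so trailing
-- zeros are irrelevant.
module PolyOver {c ℓ : Level} (R : CommutativeRing c ℓ) where
  open CommutativeRing R public

  Poly : Set c
  Poly = List Carrier

  coeff : Poly → ℕ → Carrier
  coeff []       _       = 0#
  coeff (a ∷ p)  zero    = a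
  coeff (a ∷ p)  (suc n) = coeff p n

  infix 4 _≈ₚ_
  _≈ₚ_ : Poly → Poly → Set ℓ
  p ≈ₚ q = ∀ n → coeff p n ≈ coeff q n

  0ₚ : Poly
  0ₚ = []

  infixl 6 _+ₚ_
  _+ₚ_ : Poly → Poly → Poly
  []      +ₚ q       = q
  (a ∷ p) +ₚ []      = a ∷ p
  (a ∷ p) +ₚ (b ∷ q) = (a + b) ∷ (p +ₚ q)

  _·ₚ_ : Carrier → Poly → Poly
  a ·ₚ []      = []
  a ·ₚ (b ∷ q) = (a * b) ∷ (a ·ₚ q)

  infixl 7 _*ₚ_
  _*ₚ_ : Poly → Poly → Poly
  p *ₚ q = foldr (λ a acc → (a ·ₚ q) +ₚ (0# ∷ acc)) [] p

  natMul : ℕ → Carrier → Carrier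
  natMul zero    x = 0#
  natMul (suc n) x = x + natMul n x

  derivFrom : ℕ → Poly → Poly
  derivFrom n []      = []
  derivFrom n (b ∷ q) = natMul n b ∷ derivFrom (suc n) q

  deriv : Poly → Poly
  deriv []      = []
  deriv (a ∷ p) = derivFrom 1 p

  compose : Poly → Poly → Poly
  compose f F = foldr (λ a acc → (a ∷ []) +ₚ (F *ₚ acc)) [] f

  Degree : Poly → ℕ → Set ℓ
  Degree p d = ¬ (coeff p d ≈ 0#) × (∀ m → d < m → coeff p m ≈ 0#)

  infix 4 _∣ₚ_
  _∣ₚ_ : Poly → Poly → Set (c ⊔ ℓ)
  g ∣ₚ h = Σ Poly λ q → h ≈ₚ g *ₚ q

  SquareFree : Poly → Set (c ⊔ ℓ)
  SquareFree A = ∀ P Q → A ≈ₚ (P *ₚ P) *ₚ Q → Degree P 0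

  cubicDisc : Poly → Carrier
  cubicDisc f =
    b * b * c' * c'
    - natMul 4 (a * c' * c' * c')
    - natMul 4 (b * b * b * e)
    - natMul 27 (a * a * e * e)
    + natMul 18 (a * b * c' * e)
    where
    a  = coeff f 3
    b  = coeff f 2
    c' = coeff f 1
    e  = coeff f 0

  -- y² = f(x) defines an elliptic curve (k of characteristic ≠ 2):
  -- f is a cubic with nonzero discriminant
  EllipticCubic : Poly → Set ℓ
  EllipticCubic f = Degree f 3 × ¬ (cubicDisc f ≈ 0#)

-- Generically, a cubic f and its derivative f′ generate the negated discriminant:
-- u f + v f′ = −Δ(f) for polynomials u, v with integer coefficients.  Substituting x = F
-- and multiplying by F′ gives u F′ f(F) + v f(F)′ = −Δ F′, and G divides both
-- f(F) = A G² and f(F)′ = A′ G² + 2 A G G′; as Δ is a unit, G divides F′.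
-- Comparing degrees in A G² = f(F) gives d + 2 deg G = 3 deg F, while deg G ≤ deg F′ < deg F,
-- so d ≤ 3 deg F and deg F ≤ d − 2.
module Submission where

open import Defs
open import Algebra.Bundles using (CommutativeRing)
open import Algebra.Solver.Ring.AlmostCommutativeRing
  using (fromCommutativeRing; _-Raw-AlmostCommutative⟶_)
open import Data.Empty using (⊥-elim)
open import Data.Integer as ℤ using (ℤ; +_; _⊖_; _◃_; sign; ∣_∣; -[1+_])
import Data.Integer.Properties as ℤ
open import Data.List using ([]; _∷_)
open import Data.Maybe using (Maybe; just; nothing)
open import Data.Nat as ℕ using (ℕ; zero; suc; _≤_; _<_; _∸_; _%_; z≤n; s≤s)
import Data.Nat.Properties as ℕ
open import Data.Product using (Σ; ∃; ∃₂; _×_; _,_; proj₁; proj₂)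
open import Data.Sign as Sign using (Sign)
open import Data.Sum using (_⊎_; inj₁; inj₂)
open import Relation.Binary.Bundles using (Setoid)
open import Relation.Binary.PropositionalEquality as ≡ using (_≡_)
open import Relation.Nullary using (¬_; yes; no)

module IntegerCoefficientSolver {r₁ r₂} (R : CommutativeRing r₁ r₂) where
  open CommutativeRing R
  open import Algebra.Properties.Ring ring
    using (-0#≈0#; -‿involutive; -‿+-comm; -‿distribˡ-*; -‿distribʳ-*)
  open import Algebra.Properties.Semiring.Mult semiring
    using (×-homo-+; ×1-homo-*) renaming (_×_ to _·_)
  open import Algebra.Properties.CommutativeSemigroup +-commutativeSemigroup
    using (interchange)
  open import Relation.Binary.Reasoning.Setoid setoid

  signed : Sign → Carrier → Carrier
  signed Sign.+ x = x
  signed Sign.- x = - x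

  fromℤ : ℤ → Carrier
  fromℤ i = signed (sign i) (∣ i ∣ · 1#)

  signed-cong : ∀ s {x y} → x ≈ y → signed s x ≈ signed s y
  signed-cong Sign.+ x≈y = x≈y
  signed-cong Sign.- x≈y = -‿cong x≈y

  signed-* : ∀ s t x y → signed (s Sign.* t) (x * y) ≈ signed s x * signed t y
  signed-* Sign.+ Sign.+ x y = refl
  signed-* Sign.+ Sign.- x y = -‿distribʳ-* x y
  signed-* Sign.- Sign.+ x y = -‿distribˡ-* x y
  signed-* Sign.- Sign.- x y = begin
    x * y         ≈⟨ -‿involutive (x * y) ⟨
    - - (x * y)   ≈⟨ -‿cong (-‿distribˡ-* x y) ⟩
    - (- x * y)   ≈⟨ -‿distribʳ-* (- x) y ⟩
    - x * - y     ∎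

  fromℤ-◃ : ∀ s n → fromℤ (s ◃ n) ≈ signed s (n · 1#)
  fromℤ-◃ Sign.+ zero    = refl
  fromℤ-◃ Sign.- zero    = sym -0#≈0#
  fromℤ-◃ Sign.+ (suc n) = refl
  fromℤ-◃ Sign.- (suc n) = refl

  fromℤ-⊖ : ∀ m n → fromℤ (m ⊖ n) ≈ m · 1# - n · 1#
  fromℤ-⊖ zero    zero    = sym (trans (+-identityˡ _) -0#≈0#)
  fromℤ-⊖ (suc m) zero    = sym (trans (+-congˡ -0#≈0#) (+-identityʳ _))
  fromℤ-⊖ zero    (suc n) = sym (+-identityˡ _)
  fromℤ-⊖ (suc m) (suc n) = begin
    fromℤ (suc m ⊖ suc n)               ≡⟨ ≡.cong fromℤ (ℤ.[1+m]⊖[1+n]≡m⊖n m n) ⟩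
    fromℤ (m ⊖ n)                       ≈⟨ fromℤ-⊖ m n ⟩
    m · 1# - n · 1#                     ≈⟨ +-identityˡ _ ⟨
    0# + (m · 1# - n · 1#)              ≈⟨ +-congʳ (-‿inverseʳ 1#) ⟨
    (1# - 1#) + (m · 1# - n · 1#)       ≈⟨ interchange 1# (- 1#) (m · 1#) (- (n · 1#)) ⟩
    suc m · 1# + (- 1# + - (n · 1#))    ≈⟨ +-congˡ (-‿+-comm 1# (n · 1#)) ⟩
    suc m · 1# - suc n · 1#             ∎

  fromℤ-+ : ∀ i j → fromℤ (i ℤ.+ j) ≈ fromℤ i + fromℤ j
  fromℤ-+ -[1+ m ] -[1+ n ] = begin
    - (suc (suc (m ℕ.+ n)) · 1#)        ≡⟨ ≡.cong (λ k → - (k · 1#)) (ℕ.+-suc (suc m) n) ⟨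
    - ((suc m ℕ.+ suc n) · 1#)          ≈⟨ -‿cong (×-homo-+ 1# (suc m) (suc n)) ⟩
    - (suc m · 1# + suc n · 1#)         ≈⟨ -‿+-comm _ _ ⟨
    - (suc m · 1#) + - (suc n · 1#)     ∎
  fromℤ-+ -[1+ m ] (+ n)    = trans (fromℤ-⊖ n (suc m)) (+-comm _ _)
  fromℤ-+ (+ m)    -[1+ n ] = fromℤ-⊖ m (suc n)
  fromℤ-+ (+ m)    (+ n)    = ×-homo-+ 1# m n

  fromℤ-* : ∀ i j → fromℤ (i ℤ.* j) ≈ fromℤ i * fromℤ j
  fromℤ-* i j = begin
    fromℤ (sign i Sign.* sign j ◃ ∣ i ∣ ℕ.* ∣ j ∣)          ≈⟨ fromℤ-◃ (sign i Sign.* sign j) (∣ i ∣ ℕ.* ∣ j ∣) ⟩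
    signed (sign i Sign.* sign j) ((∣ i ∣ ℕ.* ∣ j ∣) · 1#)  ≈⟨ signed-cong (sign i Sign.* sign j) (×1-homo-* ∣ i ∣ ∣ j ∣) ⟩
    signed (sign i Sign.* sign j) (∣ i ∣ · 1# * ∣ j ∣ · 1#) ≈⟨ signed-* (sign i) (sign j) _ _ ⟩
    fromℤ i * fromℤ j                                       ∎

  fromℤ-neg : ∀ i → fromℤ (ℤ.- i) ≈ - fromℤ i
  fromℤ-neg -[1+ n ]   = sym (-‿involutive _)
  fromℤ-neg (+ zero)   = sym -0#≈0#
  fromℤ-neg (+ suc n)  = refl

  fromℤ-homomorphism : ℤ.+-*-rawRing -Raw-AlmostCommutative⟶ fromCommutativeRing R
  fromℤ-homomorphism = record
    { ⟦_⟧    = fromℤ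
    ; +-homo = fromℤ-+
    ; *-homo = fromℤ-*
    ; -‿homo = fromℤ-neg
    ; 0-homo = refl
    ; 1-homo = +-identityʳ 1#
    }

  coefficients≟ : ∀ i j → Maybe (fromℤ i ≈ fromℤ j)
  coefficients≟ i j with i ℤ.≟ j
  ... | yes ≡.refl = just refl
  ... | no _       = nothing

  open import Algebra.Solver.Ring ℤ.+-*-rawRing (fromCommutativeRing R) fromℤ-homomorphism coefficients≟ public

module CubicIdentities {r₁ r₂} (S : CommutativeRing r₁ r₂) where
  open CommutativeRing S
  open PolyOver S using (natMul)
  open IntegerCoefficientSolver S using (solve; _:+_; _:-_; _:*_; _:×_; :-_; _:=_)

  cubic : (a b c e x : Carrier) → Carrier
  cubic a b c e x = e + x * (c + x * (b + x * a))

  cubic′ : (a b c x : Carrier) → Carrier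
  cubic′ a b c x = c + x * ((b + b) + x * (a + (a + a)))

  -- Defs.cubicDisc f unfolds to discriminant (coeff f 3) (coeff f 2) (coeff f 1) (coeff f 0).
  discriminant : (a b c e : Carrier) → Carrier
  discriminant a b c e =
    b * b * c * c
    - natMul 4 (a * c * c * c)
    - natMul 4 (b * b * b * e)
    - natMul 27 (a * a * e * e)
    + natMul 18 (a * b * c * e)

  cubic-bezout : ∀ a b c e x → ∃₂ λ u v → u * cubic a b c e x + v * cubic′ a b c x ≈ - discriminant a b c e
  cubic-bezout a b c e x = u , v , solve 5 (λ a b c e x →
      (4 :× (b :* b :* b) :- 15 :× (a :* b :* c) :+ 27 :× (a :* a :* e)
        :+ (6 :× (a :* b :* b) :- 18 :× (a :* a :* c)) :* x)
      :* (e :+ x :* (c :+ x :* (b :+ x :* a)))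
      :+ (4 :× (a :* c :* c) :- b :* b :* c :- 3 :× (a :* b :* e)
        :+ (7 :× (a :* b :* c) :- 2 :× (b :* b :* b) :- 9 :× (a :* a :* e)) :* x
        :+ (6 :× (a :* a :* c) :- 2 :× (a :* b :* b)) :* (x :* x))
      :* (c :+ x :* ((b :+ b) :+ x :* (a :+ (a :+ a))))
      := :- (b :* b :* c :* c :- 4 :× (a :* c :* c :* c) :- 4 :× (b :* b :* b :* e)
             :- 27 :× (a :* a :* e :* e) :+ 18 :× (a :* b :* c :* e))) refl a b c e x
    where
    u v : Carrier
    u = natMul 4 (b * b * b) - natMul 15 (a * b * c) + natMul 27 (a * a * e)
        + (natMul 6 (a * b * b) - natMul 18 (a * a * c)) * x
    v = natMul 4 (a * c * c) - b * b * c - natMul 3 (a * b * e)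
        + (natMul 7 (a * b * c) - natMul 2 (b * b * b) - natMul 9 (a * a * e)) * x
        + (natMul 6 (a * a * c) - natMul 2 (a * b * b)) * (x * x)

module UnitsAndDivisibility {r₁ r₂} (S : CommutativeRing r₁ r₂) where
  open CommutativeRing S
  open import Algebra.Properties.Semiring.Divisibility semiring public
    using (_∣_; _,_; ∣ʳ-respʳ-≈; xy≈z⇒y∣ʳz; x∣ʳy⇒x∣ʳzy)
  open import Relation.Binary.Reasoning.Setoid setoid

  unit-*-zero : ∀ {x x⁻¹ y} → x⁻¹ * x ≈ 1# → x * y ≈ 0# → y ≈ 0#
  unit-*-zero {x} {x⁻¹} {y} x⁻¹x≈1 xy≈0 = begin
    y              ≈⟨ *-identityˡ y ⟨
    1# * y         ≈⟨ *-congʳ x⁻¹x≈1 ⟨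
    x⁻¹ * x * y    ≈⟨ *-assoc x⁻¹ x y ⟩
    x⁻¹ * (x * y)  ≈⟨ *-congˡ xy≈0 ⟩
    x⁻¹ * 0#       ≈⟨ zeroʳ x⁻¹ ⟩
    0#             ∎

  ∣-+ : ∀ {g p q} → g ∣ p → g ∣ q → g ∣ p + q
  ∣-+ {g} (k , kg≈p) (l , lg≈q) = k + l , trans (distribʳ g k l) (+-cong kg≈p lg≈q)

  ∣-cancel-comaximal : ∀ {g p q w δ δ⁻¹} → δ⁻¹ * δ ≈ 1# → (∃₂ λ u v → u * p + v * q ≈ δ) →
                       g ∣ p * w → g ∣ q * w → g ∣ w
  ∣-cancel-comaximal {g} {p} {q} {w} {δ} {δ⁻¹} δ⁻¹δ≈1 (u , v , up+vq≈δ) g∣pw g∣qw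
    with ∣-+ (x∣ʳy⇒x∣ʳzy u g∣pw) (x∣ʳy⇒x∣ʳzy v g∣qw)
  ... | k , kg≈upw+vqw = δ⁻¹ * k , (begin
    δ⁻¹ * k * g                      ≈⟨ *-assoc δ⁻¹ k g ⟩
    δ⁻¹ * (k * g)                    ≈⟨ *-congˡ kg≈upw+vqw ⟩
    δ⁻¹ * (u * (p * w) + v * (q * w)) ≈⟨ *-congˡ (+-cong (*-assoc u p w) (*-assoc v q w)) ⟨
    δ⁻¹ * (u * p * w + v * q * w)    ≈⟨ *-congˡ (distribʳ w (u * p) (v * q)) ⟨
    δ⁻¹ * ((u * p + v * q) * w)      ≈⟨ *-congˡ (*-congʳ up+vq≈δ) ⟩
    δ⁻¹ * (δ * w)                    ≈⟨ *-assoc δ⁻¹ δ w ⟨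
    δ⁻¹ * δ * w                      ≈⟨ *-congʳ δ⁻¹δ≈1 ⟩
    1# * w                           ≈⟨ *-identityˡ w ⟩
    w                                ∎)

module Polynomials {c ℓ} (R : CommutativeRing c ℓ) where
  open PolyOver R
  open import Algebra.Properties.Ring ring using (-0#≈0#)
  open import Algebra.Properties.CommutativeSemigroup +-commutativeSemigroup
    using (interchange)

  C : Carrier → Poly
  C x = x ∷ []

  1ₚ : Poly
  1ₚ = C 1#

  negₚ : Poly → Poly
  negₚ []      = []
  negₚ (a ∷ p) = - a ∷ negₚ p

  coeff-+ₚ : ∀ p q n → coeff (p +ₚ q) n ≈ coeff p n + coeff q n
  coeff-+ₚ []      q       n       = sym (+-identityˡ _)
  coeff-+ₚ (a ∷ p) []      n       = sym (+-identityʳ _)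
  coeff-+ₚ (a ∷ p) (b ∷ q) zero    = refl
  coeff-+ₚ (a ∷ p) (b ∷ q) (suc n) = coeff-+ₚ p q n

  coeff-·ₚ : ∀ a q n → coeff (a ·ₚ q) n ≈ a * coeff q n
  coeff-·ₚ a []      n       = sym (zeroʳ a)
  coeff-·ₚ a (b ∷ q) zero    = refl
  coeff-·ₚ a (b ∷ q) (suc n) = coeff-·ₚ a q n

  coeff-negₚ : ∀ p n → coeff (negₚ p) n ≈ - coeff p n
  coeff-negₚ []      n       = sym -0#≈0#
  coeff-negₚ (a ∷ p) zero    = refl
  coeff-negₚ (a ∷ p) (suc n) = coeff-negₚ p n

  -- A record wrapper around _≈ₚ_: unlike the function type it is injective,
  -- so both polynomials can be inferred from a proof.
  infix 4 _≋_
  record _≋_ (p q : Poly) : Set ℓ where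
    constructor mk≋
    field coeff≈ : p ≈ₚ q
  open _≋_ public

  ≋-refl : ∀ {p} → p ≋ p
  ≋-refl = mk≋ λ _ → refl

  ≋-sym : ∀ {p q} → p ≋ q → q ≋ p
  ≋-sym (mk≋ e) = mk≋ λ n → sym (e n)

  ≋-trans : ∀ {p q r} → p ≋ q → q ≋ r → p ≋ r
  ≋-trans (mk≋ e) (mk≋ f) = mk≋ λ n → trans (e n) (f n)

  ≋-setoid : Setoid c ℓ
  ≋-setoid = record
    { _≈_           = _≋_
    ; isEquivalence = record { refl = ≋-refl ; sym = ≋-sym ; trans = ≋-trans }
    }

  open import Relation.Binary.Reasoning.Setoid ≋-setoid

  ∷-cong : ∀ {a b p q} → a ≈ b → p ≋ q → a ∷ p ≋ b ∷ q
  ∷-cong a≈b (mk≋ e) = mk≋ λ { zero → a≈b ; (suc n) → e n }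

  0∷-zero : ∀ {p} → p ≋ [] → 0# ∷ p ≋ []
  0∷-zero (mk≋ e) = mk≋ λ { zero → refl ; (suc n) → e n }

  +ₚ-cong : ∀ {p p′ q q′} → p ≋ p′ → q ≋ q′ → p +ₚ q ≋ p′ +ₚ q′
  +ₚ-cong {p} {p′} {q} {q′} (mk≋ e) (mk≋ f) = mk≋ λ n →
    trans (coeff-+ₚ p q n) (trans (+-cong (e n) (f n)) (sym (coeff-+ₚ p′ q′ n)))

  +ₚ-comm : ∀ p q → p +ₚ q ≋ q +ₚ p
  +ₚ-comm p q = mk≋ λ n → trans (coeff-+ₚ p q n) (trans (+-comm _ _) (sym (coeff-+ₚ q p n)))

  +ₚ-assoc : ∀ p q r → (p +ₚ q) +ₚ r ≋ p +ₚ (q +ₚ r)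
  +ₚ-assoc p q r = mk≋ λ n →
    trans (trans (coeff-+ₚ (p +ₚ q) r n) (+-congʳ (coeff-+ₚ p q n)))
      (trans (+-assoc _ _ _) (sym (trans (coeff-+ₚ p (q +ₚ r) n) (+-congˡ (coeff-+ₚ q r n)))))

  +ₚ-identityʳ : ∀ p → p +ₚ [] ≋ p
  +ₚ-identityʳ p = mk≋ λ n → trans (coeff-+ₚ p [] n) (+-identityʳ _)

  +ₚ-interchange : ∀ p q r s → (p +ₚ q) +ₚ (r +ₚ s) ≋ (p +ₚ r) +ₚ (q +ₚ s)
  +ₚ-interchange p q r s = mk≋ λ n →
    trans (trans (coeff-+ₚ (p +ₚ q) (r +ₚ s) n) (+-cong (coeff-+ₚ p q n) (coeff-+ₚ r s n)))
      (trans (interchange _ _ _ _)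
        (sym (trans (coeff-+ₚ (p +ₚ r) (q +ₚ s) n) (+-cong (coeff-+ₚ p r n) (coeff-+ₚ q s n)))))

  negₚ-cong : ∀ {p q} → p ≋ q → negₚ p ≋ negₚ q
  negₚ-cong {p} {q} (mk≋ e) = mk≋ λ n →
    trans (coeff-negₚ p n) (trans (-‿cong (e n)) (sym (coeff-negₚ q n)))

  negₚ-inverseʳ : ∀ p → p +ₚ negₚ p ≋ []
  negₚ-inverseʳ p = mk≋ λ n →
    trans (coeff-+ₚ p (negₚ p) n) (trans (+-congˡ (coeff-negₚ p n)) (-‿inverseʳ _))

  ·ₚ-cong : ∀ {a b p q} → a ≈ b → p ≋ q → a ·ₚ p ≋ b ·ₚ q
  ·ₚ-cong {a} {b} {p} {q} a≈b (mk≋ e) = mk≋ λ n →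
    trans (coeff-·ₚ a p n) (trans (*-cong a≈b (e n)) (sym (coeff-·ₚ b q n)))

  ·ₚ-distribˡ : ∀ a p q → a ·ₚ (p +ₚ q) ≋ a ·ₚ p +ₚ a ·ₚ q
  ·ₚ-distribˡ a p q = mk≋ λ n →
    trans (trans (coeff-·ₚ a (p +ₚ q) n) (*-congˡ (coeff-+ₚ p q n)))
      (trans (distribˡ _ _ _)
        (sym (trans (coeff-+ₚ (a ·ₚ p) (a ·ₚ q) n) (+-cong (coeff-·ₚ a p n) (coeff-·ₚ a q n)))))

  ·ₚ-distribʳ : ∀ a b q → (a + b) ·ₚ q ≋ a ·ₚ q +ₚ b ·ₚ q
  ·ₚ-distribʳ a b q = mk≋ λ n →
    trans (coeff-·ₚ (a + b) q n)
      (trans (distribʳ _ _ _)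
        (sym (trans (coeff-+ₚ (a ·ₚ q) (b ·ₚ q) n) (+-cong (coeff-·ₚ a q n) (coeff-·ₚ b q n)))))

  ·ₚ-assoc : ∀ a b p → a ·ₚ (b ·ₚ p) ≋ (a * b) ·ₚ p
  ·ₚ-assoc a b p = mk≋ λ n →
    trans (trans (coeff-·ₚ a (b ·ₚ p) n) (*-congˡ (coeff-·ₚ b p n)))
      (trans (sym (*-assoc _ _ _)) (sym (coeff-·ₚ (a * b) p n)))

  ·ₚ-zeroˡ : ∀ p → 0# ·ₚ p ≋ []
  ·ₚ-zeroˡ p = mk≋ λ n → trans (coeff-·ₚ 0# p n) (zeroˡ _)

  ·ₚ-identityˡ : ∀ p → 1# ·ₚ p ≋ p
  ·ₚ-identityˡ p = mk≋ λ n → trans (coeff-·ₚ 1# p n) (*-identityˡ _)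

  *ₚ-zeroʳ : ∀ p → p *ₚ [] ≋ []
  *ₚ-zeroʳ []      = ≋-refl
  *ₚ-zeroʳ (a ∷ p) = 0∷-zero (*ₚ-zeroʳ p)

  *ₚ-congˡ : ∀ p {q q′} → q ≋ q′ → p *ₚ q ≋ p *ₚ q′
  *ₚ-congˡ []      q≋q′ = ≋-refl
  *ₚ-congˡ (a ∷ p) q≋q′ = +ₚ-cong (·ₚ-cong refl q≋q′) (∷-cong refl (*ₚ-congˡ p q≋q′))

  *ₚ-∷ʳ : ∀ p b q → p *ₚ (b ∷ q) ≋ b ·ₚ p +ₚ (0# ∷ p *ₚ q)
  *ₚ-∷ʳ []      b q = ≋-sym (0∷-zero ≋-refl)
  *ₚ-∷ʳ (a ∷ p) b q = ∷-cong (+-congʳ (*-comm a b)) (begin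
    a ·ₚ q +ₚ p *ₚ (b ∷ q)                  ≈⟨ +ₚ-cong ≋-refl (*ₚ-∷ʳ p b q) ⟩
    a ·ₚ q +ₚ (b ·ₚ p +ₚ (0# ∷ p *ₚ q))     ≈⟨ +ₚ-assoc (a ·ₚ q) _ _ ⟨
    (a ·ₚ q +ₚ b ·ₚ p) +ₚ (0# ∷ p *ₚ q)     ≈⟨ +ₚ-cong (+ₚ-comm (a ·ₚ q) _) ≋-refl ⟩
    (b ·ₚ p +ₚ a ·ₚ q) +ₚ (0# ∷ p *ₚ q)     ≈⟨ +ₚ-assoc (b ·ₚ p) _ _ ⟩
    b ·ₚ p +ₚ (a ·ₚ q +ₚ (0# ∷ p *ₚ q))     ∎)

  *ₚ-comm : ∀ p q → p *ₚ q ≋ q *ₚ p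
  *ₚ-comm []      q = ≋-sym (*ₚ-zeroʳ q)
  *ₚ-comm (a ∷ p) q = ≋-trans (+ₚ-cong ≋-refl (∷-cong refl (*ₚ-comm p q))) (≋-sym (*ₚ-∷ʳ q a p))

  *ₚ-cong : ∀ {p p′ q q′} → p ≋ p′ → q ≋ q′ → p *ₚ q ≋ p′ *ₚ q′
  *ₚ-cong {p} {p′} {q} {q′} p≋p′ q≋q′ = begin
    p *ₚ q    ≈⟨ *ₚ-congˡ p q≋q′ ⟩
    p *ₚ q′   ≈⟨ *ₚ-comm p q′ ⟩
    q′ *ₚ p   ≈⟨ *ₚ-congˡ q′ p≋p′ ⟩
    q′ *ₚ p′  ≈⟨ *ₚ-comm q′ p′ ⟩
    p′ *ₚ q′  ∎

  *ₚ-distribʳ : ∀ p p′ q → (p +ₚ p′) *ₚ q ≋ p *ₚ q +ₚ p′ *ₚ q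
  *ₚ-distribʳ []      p′       q = ≋-refl
  *ₚ-distribʳ (a ∷ p) []       q = ≋-sym (+ₚ-identityʳ _)
  *ₚ-distribʳ (a ∷ p) (b ∷ p′) q = begin
    (a + b) ·ₚ q +ₚ (0# ∷ (p +ₚ p′) *ₚ q)
      ≈⟨ +ₚ-cong (·ₚ-distribʳ a b q) (∷-cong (sym (+-identityʳ 0#)) (*ₚ-distribʳ p p′ q)) ⟩
    (a ·ₚ q +ₚ b ·ₚ q) +ₚ ((0# ∷ p *ₚ q) +ₚ (0# ∷ p′ *ₚ q))
      ≈⟨ +ₚ-interchange (a ·ₚ q) _ _ _ ⟩
    (a ·ₚ q +ₚ (0# ∷ p *ₚ q)) +ₚ (b ·ₚ q +ₚ (0# ∷ p′ *ₚ q)) ∎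

  ·ₚ-*ₚ-assoc : ∀ a q r → (a ·ₚ q) *ₚ r ≋ a ·ₚ (q *ₚ r)
  ·ₚ-*ₚ-assoc a []      r = ≋-refl
  ·ₚ-*ₚ-assoc a (b ∷ q) r = begin
    (a * b) ·ₚ r +ₚ (0# ∷ (a ·ₚ q) *ₚ r)
      ≈⟨ +ₚ-cong (≋-sym (·ₚ-assoc a b r)) (∷-cong (sym (zeroʳ a)) (·ₚ-*ₚ-assoc a q r)) ⟩
    a ·ₚ (b ·ₚ r) +ₚ a ·ₚ (0# ∷ q *ₚ r) ≈⟨ ·ₚ-distribˡ a (b ·ₚ r) _ ⟨
    a ·ₚ (b ·ₚ r +ₚ (0# ∷ q *ₚ r))      ∎

  0∷-*ₚ : ∀ p q → (0# ∷ p) *ₚ q ≋ 0# ∷ p *ₚ q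
  0∷-*ₚ p q = +ₚ-cong (·ₚ-zeroˡ q) ≋-refl

  *ₚ-assoc : ∀ p q r → (p *ₚ q) *ₚ r ≋ p *ₚ (q *ₚ r)
  *ₚ-assoc []      q r = ≋-refl
  *ₚ-assoc (a ∷ p) q r = begin
    (a ·ₚ q +ₚ (0# ∷ p *ₚ q)) *ₚ r         ≈⟨ *ₚ-distribʳ (a ·ₚ q) _ r ⟩
    (a ·ₚ q) *ₚ r +ₚ (0# ∷ p *ₚ q) *ₚ r    ≈⟨ +ₚ-cong (·ₚ-*ₚ-assoc a q r) (0∷-*ₚ (p *ₚ q) r) ⟩
    a ·ₚ (q *ₚ r) +ₚ (0# ∷ (p *ₚ q) *ₚ r)  ≈⟨ +ₚ-cong ≋-refl (∷-cong refl (*ₚ-assoc p q r)) ⟩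
    a ·ₚ (q *ₚ r) +ₚ (0# ∷ p *ₚ (q *ₚ r))  ∎

  *ₚ-identityˡ : ∀ q → 1ₚ *ₚ q ≋ q
  *ₚ-identityˡ q = ≋-trans (+ₚ-cong (·ₚ-identityˡ q) (0∷-zero ≋-refl)) (+ₚ-identityʳ q)

  polynomialRing : CommutativeRing c ℓ
  polynomialRing = record
    { Carrier = Poly ; _≈_ = _≋_ ; _+_ = _+ₚ_ ; _*_ = _*ₚ_ ; -_ = negₚ ; 0# = [] ; 1# = 1ₚ
    ; isCommutativeRing = record
      { isRing = record
        { +-isAbelianGroup = record
          { isGroup = record
            { isMonoid = record
              { isSemigroup = record
                { isMagma = record
                  { isEquivalence = Setoid.isEquivalence ≋-setoid ; ∙-cong = +ₚ-cong }
                ; assoc = +ₚ-assoc }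
              ; identity = (λ _ → ≋-refl) , +ₚ-identityʳ }
            ; inverse = (λ p → ≋-trans (+ₚ-comm (negₚ p) p) (negₚ-inverseʳ p)) , negₚ-inverseʳ
            ; ⁻¹-cong = negₚ-cong }
          ; comm = +ₚ-comm }
        ; *-cong = *ₚ-cong
        ; *-assoc = *ₚ-assoc
        ; *-identity = *ₚ-identityˡ , λ q → ≋-trans (*ₚ-comm q 1ₚ) (*ₚ-identityˡ q)
        ; distrib = (λ p q q′ → ≋-trans (*ₚ-comm p _)
                                  (≋-trans (*ₚ-distribʳ q q′ p) (+ₚ-cong (*ₚ-comm q p) (*ₚ-comm q′ p))))
                  , (λ q p p′ → *ₚ-distribʳ p p′ q) }
      ; *-comm = *ₚ-comm } }

  -- Formal derivative

  natMul-zeroʳ : ∀ n → natMul n 0# ≈ 0#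
  natMul-zeroʳ zero    = refl
  natMul-zeroʳ (suc n) = trans (+-identityˡ _) (natMul-zeroʳ n)

  natMul-congʳ : ∀ n {x y} → x ≈ y → natMul n x ≈ natMul n y
  natMul-congʳ zero    x≈y = refl
  natMul-congʳ (suc n) x≈y = +-cong x≈y (natMul-congʳ n x≈y)

  natMul-distrib-+ : ∀ n x y → natMul n (x + y) ≈ natMul n x + natMul n y
  natMul-distrib-+ zero    x y = sym (+-identityˡ 0#)
  natMul-distrib-+ (suc n) x y =
    trans (+-congˡ (natMul-distrib-+ n x y)) (interchange x y (natMul n x) (natMul n y))

  natMul-comm-* : ∀ n a x → natMul n (a * x) ≈ a * natMul n x
  natMul-comm-* zero    a x = sym (zeroʳ a)
  natMul-comm-* (suc n) a x = trans (+-congˡ (natMul-comm-* n a x)) (sym (distribˡ a x (natMul n x)))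

  coeff-derivFrom : ∀ n p k → coeff (derivFrom n p) k ≈ natMul (n ℕ.+ k) (coeff p k)
  coeff-derivFrom n []      k       = sym (natMul-zeroʳ (n ℕ.+ k))
  coeff-derivFrom n (b ∷ q) zero    = reflexive (≡.cong (λ m → natMul m b) (≡.sym (ℕ.+-identityʳ n)))
  coeff-derivFrom n (b ∷ q) (suc k) =
    trans (coeff-derivFrom (suc n) q k) (reflexive (≡.cong (λ m → natMul m (coeff q k)) (≡.sym (ℕ.+-suc n k))))

  coeff-deriv : ∀ p k → coeff (deriv p) k ≈ natMul (suc k) (coeff p (suc k))
  coeff-deriv []      k = sym (natMul-zeroʳ (suc k))
  coeff-deriv (a ∷ p) k = coeff-derivFrom 1 p k

  deriv-cong : ∀ {p q} → p ≋ q → deriv p ≋ deriv q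
  deriv-cong {p} {q} (mk≋ e) = mk≋ λ k →
    trans (coeff-deriv p k) (trans (natMul-congʳ (suc k) (e (suc k))) (sym (coeff-deriv q k)))

  deriv-+ₚ : ∀ p q → deriv (p +ₚ q) ≋ deriv p +ₚ deriv q
  deriv-+ₚ p q = mk≋ λ k →
    trans (trans (coeff-deriv (p +ₚ q) k) (natMul-congʳ (suc k) (coeff-+ₚ p q (suc k))))
      (trans (natMul-distrib-+ (suc k) _ _)
        (sym (trans (coeff-+ₚ (deriv p) (deriv q) k) (+-cong (coeff-deriv p k) (coeff-deriv q k)))))

  deriv-·ₚ : ∀ a q → deriv (a ·ₚ q) ≋ a ·ₚ deriv q
  deriv-·ₚ a q = mk≋ λ k →
    trans (trans (coeff-deriv (a ·ₚ q) k) (natMul-congʳ (suc k) (coeff-·ₚ a q (suc k))))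
      (trans (natMul-comm-* (suc k) a _) (sym (trans (coeff-·ₚ a (deriv q) k) (*-congˡ (coeff-deriv q k)))))

  deriv-0∷ : ∀ p → deriv (0# ∷ p) ≋ p +ₚ (0# ∷ deriv p)
  deriv-0∷ p = mk≋ λ
    { zero    → trans (coeff-deriv (0# ∷ p) 0) (sym (coeff-+ₚ p (0# ∷ deriv p) 0))
    ; (suc k) → trans (coeff-deriv (0# ∷ p) (suc k))
                  (trans (+-congˡ (sym (coeff-deriv p k))) (sym (coeff-+ₚ p (0# ∷ deriv p) (suc k))))
    }

  open IntegerCoefficientSolver polynomialRing
    using (solve; con; _:+_; _:*_; _:=_)

  deriv-*ₚ : ∀ p q → deriv (p *ₚ q) ≋ deriv p *ₚ q +ₚ p *ₚ deriv q
  deriv-*ₚ []      q = ≋-refl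
  deriv-*ₚ (a ∷ p) q = begin
    deriv (a ·ₚ q +ₚ (0# ∷ p *ₚ q))
      ≈⟨ ≋-trans (deriv-+ₚ (a ·ₚ q) _) (+ₚ-cong (deriv-·ₚ a q) (deriv-0∷ (p *ₚ q))) ⟩
    a ·ₚ q′ +ₚ (p *ₚ q +ₚ (0# ∷ deriv (p *ₚ q)))
      ≈⟨ +ₚ-cong (≋-refl {a ·ₚ q′}) (+ₚ-cong (≋-refl {p *ₚ q}) (∷-cong (sym (+-identityʳ 0#)) (deriv-*ₚ p q))) ⟩
    a ·ₚ q′ +ₚ (p *ₚ q +ₚ ((0# ∷ p′ *ₚ q) +ₚ (0# ∷ p *ₚ q′)))
      ≈⟨ solve 4 (λ w x y z → w :+ (x :+ (y :+ z)) := (x :+ y) :+ (w :+ z)) ≋-refl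
           (a ·ₚ q′) (p *ₚ q) (0# ∷ p′ *ₚ q) (0# ∷ p *ₚ q′) ⟩
    (p *ₚ q +ₚ (0# ∷ p′ *ₚ q)) +ₚ (a ·ₚ q′ +ₚ (0# ∷ p *ₚ q′))
      ≈⟨ +ₚ-cong (≋-trans (+ₚ-cong (≋-refl {p *ₚ q}) (≋-sym (0∷-*ₚ p′ q))) (≋-sym (*ₚ-distribʳ p _ q))) ≋-refl ⟩
    (p +ₚ (0# ∷ p′)) *ₚ q +ₚ (a ∷ p) *ₚ q′
      ≈⟨ +ₚ-cong (*ₚ-cong (≋-sym (deriv-0∷ p)) (≋-refl {q})) (≋-refl {(a ∷ p) *ₚ q′}) ⟩
    deriv (a ∷ p) *ₚ q +ₚ (a ∷ p) *ₚ q′ ∎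
    where
    p′ q′ : Poly
    p′ = deriv p
    q′ = deriv q

  C-cong : ∀ {x y} → x ≈ y → C x ≋ C y
  C-cong x≈y = ∷-cong x≈y ≋-refl

  C-zero : ∀ {x} → x ≈ 0# → C x ≋ []
  C-zero x≈0 = mk≋ λ { zero → x≈0 ; (suc n) → refl }

  C-* : ∀ x y → C (x * y) ≋ C x *ₚ C y
  C-* x y = ∷-cong (sym (+-identityʳ _)) ≋-refl

  C-*₄ : ∀ x y z w → C (x * y * z * w) ≋ C x *ₚ C y *ₚ C z *ₚ C w
  C-*₄ x y z w = begin
    C (x * y * z * w)                  ≈⟨ C-* (x * y * z) w ⟩
    C (x * y * z) *ₚ C w               ≈⟨ *ₚ-cong (C-* (x * y) z) (≋-refl {C w}) ⟩
    C (x * y) *ₚ C z *ₚ C w            ≈⟨ *ₚ-cong (*ₚ-cong (C-* x y) (≋-refl {C z})) (≋-refl {C w}) ⟩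
    C x *ₚ C y *ₚ C z *ₚ C w           ∎

  module Scalar = CubicIdentities R
  open CubicIdentities polynomialRing using (cubic; cubic′; discriminant)
  module P = PolyOver polynomialRing using (natMul)

  C-natMul : ∀ n {x p} → C x ≋ p → C (natMul n x) ≋ P.natMul n p
  C-natMul zero    _    = C-zero refl
  C-natMul (suc n) Cx≋p = +ₚ-cong Cx≋p (C-natMul n Cx≋p)

  C-discriminant : ∀ a b c e → C (Scalar.discriminant a b c e) ≋ discriminant (C a) (C b) (C c) (C e)
  C-discriminant a b c e =
    +ₚ-cong (+ₚ-cong (+ₚ-cong (+ₚ-cong (C-*₄ b b c c)
      (negₚ-cong (C-natMul 4 (C-*₄ a c c c))))
      (negₚ-cong (C-natMul 4 (C-*₄ b b b e))))
      (negₚ-cong (C-natMul 27 (C-*₄ a a e e))))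
      (C-natMul 18 (C-*₄ a b c e))

  compose-zero : ∀ F f → f ≋ [] → compose f F ≋ []
  compose-zero F []      _       = ≋-refl
  compose-zero F (a ∷ f) (mk≋ e) =
    +ₚ-cong (C-zero (e 0)) (≋-trans (*ₚ-congˡ F (compose-zero F f (mk≋ λ n → e (suc n)))) (*ₚ-zeroʳ F))

  compose-cong : ∀ F {f g} → f ≋ g → compose f F ≋ compose g F
  compose-cong F {[]}    {g}     f≋g     = ≋-sym (compose-zero F g (≋-sym f≋g))
  compose-cong F {a ∷ f} {[]}    f≋g     = compose-zero F (a ∷ f) f≋g
  compose-cong F {a ∷ f} {b ∷ g} (mk≋ e) =
    +ₚ-cong (C-cong (e 0)) (*ₚ-congˡ F (compose-cong F {f} {g} (mk≋ λ n → e (suc n))))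

  -- Degrees

  DegreeBelow : Poly → ℕ → Set ℓ
  DegreeBelow p n = ∀ k → n ≤ k → coeff p k ≈ 0#

  degreeBelow-zero : ∀ {p} → DegreeBelow p 0 → p ≋ []
  degreeBelow-zero below = mk≋ λ k → below k z≤n

  degreeBelow-mono : ∀ {p m n} → m ≤ n → DegreeBelow p m → DegreeBelow p n
  degreeBelow-mono m≤n below k n≤k = below k (ℕ.≤-trans m≤n n≤k)

  degreeBelow-C : ∀ x → DegreeBelow (C x) 1
  degreeBelow-C x (suc k) _ = refl

  degreeBelow-deriv : ∀ {p n} → DegreeBelow p (suc n) → DegreeBelow (deriv p) n
  degreeBelow-deriv {p} below k n≤k =
    trans (coeff-deriv p k) (trans (natMul-congʳ (suc k) (below (suc k) (s≤s n≤k))) (natMul-zeroʳ (suc k)))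

  degree-resp-≋ : ∀ {p q m} → p ≋ q → Degree p m → Degree q m
  degree-resp-≋ (mk≋ e) (nz , below) = (λ q≈0 → nz (trans (e _) q≈0)) , λ k lt → trans (sym (e k)) (below k lt)

  degree-nonzero : ∀ {p m} → Degree p m → ¬ p ≋ []
  degree-nonzero (nz , _) (mk≋ e) = nz (e _)

  degree-< : ∀ {p m n} → Degree p m → DegreeBelow p n → m < n
  degree-< {m = m} {n} (nz , _) below with ℕ.<-≤-connex m n
  ... | inj₁ m<n = m<n
  ... | inj₂ n≤m = ⊥-elim (nz (below m n≤m))

  degree-unique : ∀ {p m n} → Degree p m → Degree p n → m ≡.≡ n
  degree-unique {p} dm dn =
    ℕ.≤-antisym (ℕ.≤-pred (degree-< {p} dm (proj₂ dn))) (ℕ.≤-pred (degree-< {p} dn (proj₂ dm)))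

  degree-+ₚ : ∀ {p q n} → DegreeBelow p n → Degree q n → Degree (p +ₚ q) n
  degree-+ₚ {p} {q} {n} below (nz , above) =
      (λ sum≈0 → nz (trans (sym (+-identityˡ _)) (trans (+-congʳ (sym (below n ℕ.≤-refl)))
                     (trans (sym (coeff-+ₚ p q n)) sum≈0))))
    , λ k n<k → trans (coeff-+ₚ p q k) (trans (+-cong (below k (ℕ.<⇒≤ n<k)) (above k n<k)) (+-identityʳ 0#))

  coeff-∷-*ₚ : ∀ a p q k → coeff ((a ∷ p) *ₚ q) k ≈ a * coeff q k + coeff (0# ∷ p *ₚ q) k
  coeff-∷-*ₚ a p q k = trans (coeff-+ₚ (a ·ₚ q) _ k) (+-congʳ (coeff-·ₚ a q k))

  *ₚ-leading : ∀ p q m n → DegreeBelow p (suc m) → DegreeBelow q (suc n) →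
               DegreeBelow (p *ₚ q) (suc (m ℕ.+ n)) × coeff (p *ₚ q) (m ℕ.+ n) ≈ coeff p m * coeff q n
  *ₚ-leading []      q m       n _  _  = (λ _ _ → refl) , sym (zeroˡ _)
  *ₚ-leading (a ∷ p) q zero    n bp bq =
    (λ k n<k → trans (scaled k) (trans (*-congˡ (bq k n<k)) (zeroʳ a))) , scaled n
    where
    scaled : ∀ k → coeff ((a ∷ p) *ₚ q) k ≈ a * coeff q k
    scaled k = trans (coeff-∷-*ₚ a p q k)
      (trans (+-congˡ (coeff≈ (0∷-zero (*ₚ-cong (degreeBelow-zero {p} λ i _ → bp (suc i) (s≤s z≤n)) (≋-refl {q}))) k))
        (+-identityʳ _))
  *ₚ-leading (a ∷ p) q (suc m) n bp bq = below , leading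
    where
    IH : DegreeBelow (p *ₚ q) (suc (m ℕ.+ n)) × coeff (p *ₚ q) (m ℕ.+ n) ≈ coeff p m * coeff q n
    IH = *ₚ-leading p q m n (λ k m<k → bp (suc k) (s≤s m<k)) bq
    aq-vanishes : ∀ k → m ℕ.+ n ≤ k → a * coeff q (suc k) ≈ 0#
    aq-vanishes k m+n≤k = trans (*-congˡ (bq (suc k) (s≤s (ℕ.≤-trans (ℕ.m≤n+m n m) m+n≤k)))) (zeroʳ a)
    below : DegreeBelow ((a ∷ p) *ₚ q) (suc (suc m ℕ.+ n))
    below (suc k) (s≤s m+n<k) = trans (coeff-∷-*ₚ a p q (suc k))
      (trans (+-cong (aq-vanishes k (ℕ.<⇒≤ m+n<k)) (proj₁ IH k m+n<k)) (+-identityʳ 0#))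
    leading : coeff ((a ∷ p) *ₚ q) (suc m ℕ.+ n) ≈ coeff p m * coeff q n
    leading = trans (coeff-∷-*ₚ a p q (suc (m ℕ.+ n)))
      (trans (+-cong (aq-vanishes (m ℕ.+ n) ℕ.≤-refl) (proj₂ IH)) (+-identityˡ _))

  compose-cubic : ∀ F f → DegreeBelow f 4 →
                  compose f F ≋ cubic (C (coeff f 3)) (C (coeff f 2)) (C (coeff f 1)) (C (coeff f 0)) F
  compose-cubic F f below = ≋-trans (compose-cong F f≋) (horner-cong (horner-cong (horner-cong
    (horner-end (coeff f 3)))))
    where
    f≋ : f ≋ coeff f 0 ∷ coeff f 1 ∷ coeff f 2 ∷ coeff f 3 ∷ []
    f≋ = mk≋ λ { 0 → refl ; 1 → refl ; 2 → refl ; 3 → refl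
               ; (suc (suc (suc (suc k)))) → below (4 ℕ.+ k) (s≤s (s≤s (s≤s (s≤s z≤n)))) }
    horner-cong : ∀ {x q q′} → q ≋ q′ → C x +ₚ F *ₚ q ≋ C x +ₚ F *ₚ q′
    horner-cong {x} q≋q′ = +ₚ-cong (≋-refl {C x}) (*ₚ-congˡ F q≋q′)
    horner-end : ∀ x → C x +ₚ F *ₚ [] ≋ C x
    horner-end x = ≋-trans (+ₚ-cong (≋-refl {C x}) (*ₚ-zeroʳ F)) (+ₚ-identityʳ (C x))

  deriv-horner : ∀ x F q → deriv (C x +ₚ F *ₚ q) ≋ deriv F *ₚ q +ₚ F *ₚ deriv q
  deriv-horner x F q = ≋-trans (deriv-+ₚ (C x) (F *ₚ q)) (deriv-*ₚ F q)

  deriv-cubic : ∀ a b c e F → deriv (cubic (C a) (C b) (C c) (C e) F) ≋ cubic′ (C a) (C b) (C c) F *ₚ deriv F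
  deriv-cubic a b c e F = begin
    deriv (cubic (C a) (C b) (C c) (C e) F)
      ≈⟨ deriv-horner e F (C c +ₚ F *ₚ (C b +ₚ F *ₚ C a)) ⟩
    F′ *ₚ (C c +ₚ F *ₚ (C b +ₚ F *ₚ C a)) +ₚ F *ₚ deriv (C c +ₚ F *ₚ (C b +ₚ F *ₚ C a))
      ≈⟨ +ₚ-cong ≋-refl (*ₚ-congˡ F (deriv-horner c F (C b +ₚ F *ₚ C a))) ⟩
    F′ *ₚ (C c +ₚ F *ₚ (C b +ₚ F *ₚ C a)) +ₚ F *ₚ (F′ *ₚ (C b +ₚ F *ₚ C a) +ₚ F *ₚ deriv (C b +ₚ F *ₚ C a))
      ≈⟨ +ₚ-cong ≋-refl (*ₚ-congˡ F (+ₚ-cong ≋-refl (*ₚ-congˡ F (deriv-horner b F (C a))))) ⟩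
    F′ *ₚ (C c +ₚ F *ₚ (C b +ₚ F *ₚ C a)) +ₚ F *ₚ (F′ *ₚ (C b +ₚ F *ₚ C a) +ₚ F *ₚ (F′ *ₚ C a +ₚ F *ₚ []))
      ≈⟨ solve 5 (λ a b c F F′ →
           F′ :* (c :+ F :* (b :+ F :* a)) :+ F :* (F′ :* (b :+ F :* a) :+ F :* (F′ :* a :+ F :* con (+ 0)))
           := (c :+ F :* ((b :+ b) :+ F :* (a :+ (a :+ a)))) :* F′) ≋-refl (C a) (C b) (C c) F F′ ⟩
    cubic′ (C a) (C b) (C c) F *ₚ F′ ∎
    where
    F′ : Poly
    F′ = deriv F

  open UnitsAndDivisibility polynomialRing using (_∣_; _,_)

  ∣⇒∣ₚ : ∀ {g h} → g ∣ h → g ∣ₚ h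
  ∣⇒∣ₚ {g} (q , qg≋h) = q , coeff≈ (≋-trans (≋-sym qg≋h) (*ₚ-comm q g))

  ∣-deriv-*ₚ-square : ∀ A G → G ∣ deriv (A *ₚ (G *ₚ G))
  ∣-deriv-*ₚ-square A G = deriv A *ₚ G +ₚ A *ₚ (deriv G +ₚ deriv G) , ≋-sym (begin
    deriv (A *ₚ (G *ₚ G))
      ≈⟨ ≋-trans (deriv-*ₚ A (G *ₚ G)) (+ₚ-cong ≋-refl (*ₚ-congˡ A (deriv-*ₚ G G))) ⟩
    deriv A *ₚ (G *ₚ G) +ₚ A *ₚ (deriv G *ₚ G +ₚ G *ₚ deriv G)
      ≈⟨ solve 4 (λ A A′ G G′ → A′ :* (G :* G) :+ A :* (G′ :* G :+ G :* G′)
                              := (A′ :* G :+ A :* (G′ :+ G′)) :* G) ≋-refl A (deriv A) G (deriv G) ⟩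
    (deriv A *ₚ G +ₚ A *ₚ (deriv G +ₚ deriv G)) *ₚ G ∎)

module _ where
  open import Data.Nat.Tactic.RingSolver using (solve-∀)
  open ℕ.≤-Reasoning

  degree-arithmetic : ∀ {d g e} → d ℕ.+ (g ℕ.+ g) ≡ 3 ℕ.* e → g < e → d ≤ 3 ℕ.* e × e < d ∸ 1
  degree-arithmetic {d} {g} {e} d+2g≡3e g<e =
      ≡.subst (d ≤_) d+2g≡3e (ℕ.m≤m+n d (g ℕ.+ g))
    , ℕ.∸-monoˡ-≤ 1 (ℕ.+-cancelʳ-≤ (g ℕ.+ g) (2 ℕ.+ e) d (begin
        2 ℕ.+ e ℕ.+ (g ℕ.+ g)       ≡⟨ rearrange e g ⟩
        e ℕ.+ (suc g ℕ.+ suc g)     ≤⟨ ℕ.+-monoʳ-≤ e (ℕ.+-mono-≤ g<e g<e) ⟩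
        e ℕ.+ (e ℕ.+ e)             ≡⟨ triple e ⟩
        3 ℕ.* e                     ≡⟨ d+2g≡3e ⟨
        d ℕ.+ (g ℕ.+ g)             ∎))
    where
    rearrange : ∀ e g → 2 ℕ.+ e ℕ.+ (g ℕ.+ g) ≡ e ℕ.+ (suc g ℕ.+ suc g)
    rearrange = solve-∀
    triple : ∀ e → e ℕ.+ (e ℕ.+ e) ≡ 3 ℕ.* e
    triple = solve-∀

module OverFiniteField {c ℓ} (K : FiniteField c ℓ) where
  open FiniteField K using (cring; inverse; enum)
  open PolyOver cring
  open Polynomials cring
  open CubicIdentities polynomialRing using (cubic; cubic′; discriminant; cubic-bezout)
  open UnitsAndDivisibility cring using (unit-*-zero)
  open UnitsAndDivisibility polynomialRing using (_∣_; _,_; ∣ʳ-respʳ-≈; xy≈z⇒y∣ʳz; x∣ʳy⇒x∣ʳzy; ∣-cancel-comaximal)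
  open IntegerCoefficientSolver polynomialRing using (solve; _:+_; _:*_; :-_; _:=_)
  open import Data.Fin using () renaming (_≟_ to _≟ᶠ_)
  open import Function.Bundles using (Bijection)
  open import Relation.Nullary using (Dec)
  open import Relation.Binary.Reasoning.Setoid ≋-setoid

  _≟_ : ∀ x y → Dec (x ≈ y)
  x ≟ y with Bijection.to enum x ≟ᶠ Bijection.to enum y
  ... | yes eq  = yes (Bijection.injective enum eq)
  ... | no  neq = no λ x≈y → neq (Bijection.cong enum x≈y)

  *-nonzero : ∀ {x y} → ¬ x ≈ 0# → ¬ y ≈ 0# → ¬ x * y ≈ 0#
  *-nonzero {x} {y} x≉0 y≉0 xy≈0 with inverse x x≉0
  ... | x⁻¹ , xx⁻¹≈1 = y≉0 (unit-*-zero (trans (*-comm x⁻¹ x) xx⁻¹≈1) xy≈0)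

  zero-or-degree : ∀ p → p ≋ [] ⊎ ∃ (Degree p)
  zero-or-degree []      = inj₁ ≋-refl
  zero-or-degree (a ∷ p) with zero-or-degree p
  ... | inj₂ (m , nz , above) = inj₂ (suc m , nz , λ { (suc k) (s≤s m<k) → above k m<k })
  ... | inj₁ (mk≋ p≈0) with a ≟ 0#
  ...   | yes a≈0 = inj₁ (mk≋ λ { zero → a≈0 ; (suc n) → p≈0 n })
  ...   | no  a≉0 = inj₂ (0 , a≉0 , λ { (suc k) _ → p≈0 k })

  degree-*ₚ : ∀ {p q m n} → Degree p m → Degree q n → Degree (p *ₚ q) (m ℕ.+ n)
  degree-*ₚ {p} {q} {m} {n} (p≉0 , p-above) (q≉0 , q-above) =
    (λ lead≈0 → *-nonzero p≉0 q≉0 (trans (sym (proj₂ leading)) lead≈0)) , proj₁ leading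
    where
    leading : DegreeBelow (p *ₚ q) (suc (m ℕ.+ n)) × coeff (p *ₚ q) (m ℕ.+ n) ≈ coeff p m * coeff q n
    leading = *ₚ-leading p q m n p-above q-above

  degree-C : ∀ {x} → ¬ x ≈ 0# → Degree (C x) 0
  degree-C {x} x≉0 = x≉0 , degreeBelow-C x

  degree-horner : ∀ x F q {m n} → Degree F (suc m) → Degree q n → Degree (C x +ₚ F *ₚ q) (suc m ℕ.+ n)
  degree-horner x F q deg-F deg-q =
    degree-+ₚ {C x} {F *ₚ q} (degreeBelow-mono {C x} (s≤s z≤n) (degreeBelow-C x)) (degree-*ₚ {F} {q} deg-F deg-q)

  degree-cubic : ∀ {a} b c e {F m} → ¬ a ≈ 0# → Degree F (suc m) →
                 Degree (cubic (C a) (C b) (C c) (C e) F) (3 ℕ.* suc m)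
  degree-cubic {a} b c e {F} a≉0 deg-F =
    degree-horner e F (C c +ₚ F *ₚ (C b +ₚ F *ₚ C a)) deg-F
      (degree-horner c F (C b +ₚ F *ₚ C a) deg-F (degree-horner b F (C a) deg-F (degree-C a≉0)))

  degree-divisor-< : ∀ {G H g n} → Degree G g → G ∣ H → ¬ H ≋ [] → DegreeBelow H n → g < n
  degree-divisor-< {G} {H} {g} deg-G (Q , QG≋H) H≉0 H-below with zero-or-degree Q
  ... | inj₁ Q≋0    = ⊥-elim (H≉0 (≋-trans (≋-sym QG≋H) (*ₚ-cong Q≋0 (≋-refl {G}))))
  ... | inj₂ (h , deg-Q) = ℕ.≤-trans (s≤s (ℕ.m≤n+m g h))
                             (degree-< {H} (degree-resp-≋ QG≋H (degree-*ₚ {Q} {G} deg-Q deg-G)) H-below)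

  cubic-square-factor-∣-deriv : ∀ a₃ a₂ a₁ a₀ A F G → ¬ Scalar.discriminant a₃ a₂ a₁ a₀ ≈ 0# →
                  A *ₚ (G *ₚ G) ≋ cubic (C a₃) (C a₂) (C a₁) (C a₀) F → G ∣ deriv F
  cubic-square-factor-∣-deriv a₃ a₂ a₁ a₀ A F G Δ≉0 AGG≋P =
    ∣-cancel-comaximal {δ = negₚ (discriminant (C a₃) (C a₂) (C a₁) (C a₀))} {δ⁻¹ = negₚ (C Δ⁻¹)}
      unit (cubic-bezout (C a₃) (C a₂) (C a₁) (C a₀) F) G∣PF′ G∣P′F′
    where
    Δ : Carrier
    Δ = Scalar.discriminant a₃ a₂ a₁ a₀
    Δ⁻¹ : Carrier
    Δ⁻¹ = proj₁ (inverse Δ Δ≉0)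
    G∣PF′ : G ∣ cubic (C a₃) (C a₂) (C a₁) (C a₀) F *ₚ deriv F
    G∣PF′ = ∣ʳ-respʳ-≈ (*ₚ-comm (deriv F) _)
              (x∣ʳy⇒x∣ʳzy (deriv F) (∣ʳ-respʳ-≈ AGG≋P (xy≈z⇒y∣ʳz (A *ₚ G) G (*ₚ-assoc A G G))))
    G∣P′F′ : G ∣ cubic′ (C a₃) (C a₂) (C a₁) F *ₚ deriv F
    G∣P′F′ = ∣ʳ-respʳ-≈ (≋-trans (deriv-cong AGG≋P) (deriv-cubic a₃ a₂ a₁ a₀ F)) (∣-deriv-*ₚ-square A G)
    unit : negₚ (C Δ⁻¹) *ₚ negₚ (discriminant (C a₃) (C a₂) (C a₁) (C a₀)) ≋ 1ₚ
    unit = begin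
      negₚ (C Δ⁻¹) *ₚ negₚ (discriminant (C a₃) (C a₂) (C a₁) (C a₀))
        ≈⟨ *ₚ-cong (≋-refl {negₚ (C Δ⁻¹)}) (negₚ-cong (C-discriminant a₃ a₂ a₁ a₀)) ⟨
      negₚ (C Δ⁻¹) *ₚ negₚ (C Δ) ≈⟨ solve 2 (λ x y → (:- x) :* (:- y) := y :* x) ≋-refl (C Δ⁻¹) (C Δ) ⟩
      C Δ *ₚ C Δ⁻¹               ≈⟨ C-* Δ Δ⁻¹ ⟨
      C (Δ * Δ⁻¹)                ≈⟨ C-cong (proj₂ (inverse Δ Δ≉0)) ⟩
      1ₚ                         ∎

  degree-bounds : ∀ {A d f F G} → Degree A d → Degree f 3 → A *ₚ (G *ₚ G) ≋ compose f F →
                  ¬ deriv F ≋ [] → G ∣ deriv F → Σ ℕ λ e → Degree F e × d ≤ 3 ℕ.* e × e < d ∸ 1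
  degree-bounds {F = F} _ _ _ F′≉0 _ with zero-or-degree F
  ... | inj₁ F≋0            = ⊥-elim (F′≉0 (deriv-cong F≋0))
  ... | inj₂ (zero , deg-F) = ⊥-elim (F′≉0 (degreeBelow-zero (degreeBelow-deriv {F} (proj₂ deg-F))))
  degree-bounds {A} {d} {f} {F} {G} deg-A (a₃≉0 , f-below) AGG≋fF F′≉0 G∣F′ | inj₂ (suc e , deg-F) =
    suc e , deg-F , bounds (zero-or-degree G)
    where
    P : Poly
    P = cubic (C (coeff f 3)) (C (coeff f 2)) (C (coeff f 1)) (C (coeff f 0)) F
    AGG≋P : A *ₚ (G *ₚ G) ≋ P
    AGG≋P = ≋-trans AGG≋fF (compose-cubic F f f-below)
    deg-P : Degree P (3 ℕ.* suc e)
    deg-P = degree-cubic (coeff f 2) (coeff f 1) (coeff f 0) {F} a₃≉0 deg-F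
    bounds : G ≋ [] ⊎ ∃ (Degree G) → d ≤ 3 ℕ.* suc e × suc e < d ∸ 1
    bounds (inj₁ G≋0) = ⊥-elim (degree-nonzero {P} deg-P
      (≋-trans (≋-sym AGG≋P) (≋-trans (*ₚ-congˡ A (*ₚ-cong G≋0 G≋0)) (*ₚ-zeroʳ A))))
    bounds (inj₂ (g , deg-G)) = degree-arithmetic
      (degree-unique {P} (degree-resp-≋ AGG≋P (degree-*ₚ {A} {G *ₚ G} deg-A (degree-*ₚ {G} {G} deg-G deg-G))) deg-P)
      (degree-divisor-< {G} {deriv F} deg-G G∣F′ F′≉0 (degreeBelow-deriv {F} (proj₂ deg-F)))

lemma3p2 : ∀ {c ℓ} (K : FiniteField c ℓ) →
    let open PolyOver (FiniteField.cring K)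
    in ¬ (1# + 1# ≈ 0#) →
       (A : Poly) (d : ℕ) → Degree A d → d % 2 ≡ 1 → 1 < d → SquareFree A →
       (f : Poly) → EllipticCubic f →
       (F G : Poly) → A *ₚ (G *ₚ G) ≈ₚ compose f F → ¬ (deriv F ≈ₚ 0ₚ) →
       (G ∣ₚ deriv F) × Σ ℕ (λ e → Degree F e × d ≤ 3 ℕ.* e × e < d ∸ 1)
lemma3p2 K _ A d deg-A _ _ _ f (deg-f , Δ≉0) F G AGG≈fF F′≉0 =
  ∣⇒∣ₚ G∣F′ , degree-bounds {A} {d} {f} {F} {G} deg-A deg-f (mk≋ AGG≈fF) (λ F′≋0 → F′≉0 (coeff≈ F′≋0)) G∣F′
  where
  open PolyOver (FiniteField.cring K)
  open Polynomials (FiniteField.cring K)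
  open UnitsAndDivisibility polynomialRing using (_∣_)
  open OverFiniteField K
  G∣F′ : G ∣ deriv F
  G∣F′ = cubic-square-factor-∣-deriv (coeff f 3) (coeff f 2) (coeff f 1) (coeff f 0) A F G Δ≉0
           (≋-trans (mk≋ AGG≈fF) (compose-cubic F f (proj₂ deg-f)))
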